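{- The following deterministic preemptive online algorithm for $\textsc{Part}$ is $2$-competitive for every $p\ge 2$: maintain current partition weights $w_1,\dots,w_p$ (initially all $0$), the current total weight $S$ (initially $0$) and the current maximum request $m$ (initially $0$); upon each request $x$, set $S\gets S+x$, $m\gets\max\{m,x\}$, $B\gets 2\max\{m,S/p\}$, run $\textsc{Probe}(B)$ on the sequence $w_1,w_2,\dots,w_p,x$ (treating each current partition weight as a single element), and take the resulting groups as the new partitions, i.e. current partitions grouped together by $\textsc{Probe}$ are merged by removing the separators between them, and $x$ is appended to the last group or forms a new partition.
   Context: $\textsc{Part}$: given a sequence $w_1,\dots,w_n$ of positive integers and $p\ge2$, place $p-1$ separators to split it into $p$ contiguous blocks minimizing the maximum block weight (the bottleneck value). Preemptive online model: $p$ is known, requests arrive one by one ($n$ unknown); when processing the current request the algorithm may remove previously placed separators, may insert separators only right after the current request, and never has more than $p-1$ separators in place. $\textsc{Probe}(B)$ traverses a sequence left to right, greedily adding elements to the current partition while its weight stays at most $B$ and otherwise starting a new partition. An algorithm is $c$-competitive if on every input its final bottleneck value is at most $c$ times the optimal bottleneck value. -}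

module Defs where

open import Data.Nat using (ℕ; zero; suc; _+_; _*_; _⊔_; _≤ᵇ_)
open import Data.Bool using (Bool; if_then_else_)
open import Data.List using (List; []; _∷_; _++_; foldl; foldr)
open import Data.Nat.ListAction using (sum)

-- A partition of the request sequence into contiguous blocks is represented
-- by the list of its blocks (each block = list of its requests, in order).

bottleneck : List (List ℕ) → ℕ
bottleneck = foldr (λ b acc → sum b ⊔ acc) 0

-- PROBE(B) on a sequence of elements, where each element is itself a block
-- (a current partition, treated as a single element of weight = its sum).
-- `fits w` decides whether weight w is ≤ B.
probeGo : (ℕ → Bool) → List ℕ → List (List ℕ) → List (List ℕ)
probeGo fits cur [] = cur ∷ []
probeGo fits cur (b ∷ bs) =
  if fits (sum cur + sum b)
  then probeGo fits (cur ++ b) bs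
  else cur ∷ probeGo fits b bs

probe : (ℕ → Bool) → List (List ℕ) → List (List ℕ)
probe fits [] = []
probe fits (b ∷ bs) = probeGo fits b bs

record State : Set where
  constructor st
  field
    blocks : List (List ℕ)
    total  : ℕ
    maxReq : ℕ
open State public

initState : State
initState = st [] 0 0

-- B = 2·max(m, S/p).  Since B may be rational, the test  w ≤ B  is
-- evaluated exactly as  p·w ≤ 2·max(p·m, S).
fitsB : ℕ → ℕ → ℕ → ℕ → Bool
fitsB p S m w = (p * w) ≤ᵇ (2 * ((p * m) ⊔ S))

step : ℕ → State → ℕ → State
step p (st bs S m) x =
  let S' = S + x
      m' = m ⊔ x
  in st (probe (fitsB p S' m') (bs ++ ((x ∷ []) ∷ []))) S' m'

run : ℕ → List ℕ → State
run p = foldl (step p) initState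

-- Write B = 2 max(m, S/p) for the bound used after a request.  Probe(B) only merges
-- groups whose union weighs at most B, and B never decreases, so every block always
-- weighs at most the current B.  Each time Probe starts a new group, the finished group
-- together with the next one weighs more than B; summing over consecutive pairs counts
-- every request at most twice, so k groups give (k - 1) B < 2 S ≤ p B, i.e. at most p
-- groups.  Finally both m and S/p are lower bounds on the optimal bottleneck value, so
-- the algorithm's bottleneck value is at most B ≤ 2 OPT.
module Submission where

open import Defs
open import Data.Bool using (Bool; true; false)
open import Data.List using (List; []; _∷_; _++_; [_]; concat; length; foldl; foldr)
open import Data.List.Properties using (++-assoc; ++-identityʳ; concat-++)
open import Data.List.Relation.Unary.All as All using (All; []; _∷_)
open import Data.List.Relation.Unary.All.Properties using (++⁺)
open import Data.List.Relation.Unary.Linked using (Linked; []; [-]; _∷_)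
open import Data.Nat using (ℕ; suc; _+_; _*_; _⊔_; _≤_; _<_; _≤ᵇ_; z≤n; NonZero)
open import Data.Nat.ListAction using (sum)
open import Data.Nat.ListAction.Properties using (sum-++)
open import Data.Nat.Properties
open import Data.Nat.Tactic.RingSolver using (solve-∀)
open import Data.Product using (_×_; _,_)
open import Relation.Binary.PropositionalEquality using (_≡_; refl; sym; trans; cong; cong₂; subst)
open import Relation.Nullary.Reflects using (ofʸ; ofⁿ)

maximum : List ℕ → ℕ
maximum = foldr _⊔_ 0

maximum-++ : ∀ xs ys → maximum (xs ++ ys) ≡ maximum xs ⊔ maximum ys
maximum-++ []       ys = refl
maximum-++ (x ∷ xs) ys rewrite maximum-++ xs ys = sym (⊔-assoc x (maximum xs) (maximum ys))

maximum-∷ʳ : ∀ xs x → maximum (xs ++ [ x ]) ≡ maximum xs ⊔ x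
maximum-∷ʳ xs x = trans (maximum-++ xs [ x ]) (cong (maximum xs ⊔_) (⊔-identityʳ x))

sum-∷ʳ : ∀ xs x → sum (xs ++ [ x ]) ≡ sum xs + x
sum-∷ʳ xs x = trans (sum-++ xs [ x ]) (cong (sum xs +_) (+-identityʳ x))

sum≤sum-++ : ∀ xs ys → sum xs ≤ sum (xs ++ ys)
sum≤sum-++ xs ys = ≤-trans (m≤m+n (sum xs) (sum ys)) (≤-reflexive (sym (sum-++ xs ys)))

maximum≤sum : ∀ xs → maximum xs ≤ sum xs
maximum≤sum []       = z≤n
maximum≤sum (x ∷ xs) = ⊔-lub (m≤m+n x (sum xs)) (≤-trans (maximum≤sum xs) (m≤n+m (sum xs) x))

maximum-concat≤bottleneck : ∀ P → maximum (concat P) ≤ bottleneck P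
maximum-concat≤bottleneck []      = z≤n
maximum-concat≤bottleneck (b ∷ P) rewrite maximum-++ b (concat P) =
  ⊔-mono-≤ (maximum≤sum b) (maximum-concat≤bottleneck P)

sum-concat≤length*bottleneck : ∀ P → sum (concat P) ≤ length P * bottleneck P
sum-concat≤length*bottleneck []      = z≤n
sum-concat≤length*bottleneck (b ∷ P) rewrite sum-++ b (concat P) =
  +-mono-≤ (m≤m⊔n (sum b) (bottleneck P))
    (≤-trans (sum-concat≤length*bottleneck P)
             (*-monoʳ-≤ (length P) (m≤n⊔m (sum b) (bottleneck P))))

bottleneck-lower-bound : ∀ p P → length P ≤ p →
  (p * maximum (concat P)) ⊔ sum (concat P) ≤ p * bottleneck P
bottleneck-lower-bound p P lP = ⊔-lub
  (*-monoʳ-≤ p (maximum-concat≤bottleneck P))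
  (≤-trans (sum-concat≤length*bottleneck P) (*-monoˡ-≤ (bottleneck P) lP))

bottleneck-lub : ∀ p {T} bs → All (λ b → p * sum b ≤ T) bs → p * bottleneck bs ≤ T
bottleneck-lub p {T} []       []       = subst (_≤ T) (sym (*-zeroʳ p)) z≤n
bottleneck-lub p     (b ∷ bs) (f ∷ fs) rewrite *-distribˡ-⊔ p (sum b) (bottleneck bs) =
  ⊔-lub f (bottleneck-lub p bs fs)

concat-probeGo : ∀ fits cur bs → concat (probeGo fits cur bs) ≡ cur ++ concat bs
concat-probeGo fits cur []       = refl
concat-probeGo fits cur (b ∷ bs) with fits (sum cur + sum b)
... | true  = trans (concat-probeGo fits (cur ++ b) bs) (++-assoc cur b (concat bs))
... | false = cong (cur ++_) (concat-probeGo fits b bs)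

concat-probe : ∀ fits L → concat (probe fits L) ≡ concat L
concat-probe fits []      = refl
concat-probe fits (b ∷ L) = concat-probeGo fits b L

-- Probe with the bound B = T / p, so that all comparisons stay in ℕ.
module Probe (p T : ℕ) where

  fits : ℕ → Bool
  fits w = p * w ≤ᵇ T

  Fits : List ℕ → Set
  Fits b = p * sum b ≤ T

  Overfull : List ℕ → List ℕ → Set
  Overfull g h = T < p * (sum g + sum h)

  probeGo-fits : ∀ cur bs → Fits cur → All Fits bs → All Fits (probeGo fits cur bs)
  probeGo-fits cur []       fc []         = fc ∷ []
  probeGo-fits cur (b ∷ bs) fc (fb ∷ fbs)
    with fits (sum cur + sum b) | ≤ᵇ-reflects-≤ (p * (sum cur + sum b)) T
  ... | true  | ofʸ fcb = probeGo-fits (cur ++ b) bs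
                            (subst (λ w → p * w ≤ T) (sym (sum-++ cur b)) fcb) fbs
  ... | false | _       = fc ∷ probeGo-fits b bs fb fbs

  probe-fits : ∀ L → All Fits L → All Fits (probe fits L)
  probe-fits []      []        = []
  probe-fits (b ∷ L) (fb ∷ fL) = probeGo-fits b L fb fL

  overfull-∷-probeGo : ∀ a cur bs → Overfull a cur → Linked Overfull (probeGo fits cur bs) →
    Linked Overfull (a ∷ probeGo fits cur bs)
  overfull-∷-probeGo a cur []       o _ = o ∷ [-]
  overfull-∷-probeGo a cur (b ∷ bs) o l with fits (sum cur + sum b)
  ... | true  = overfull-∷-probeGo a (cur ++ b) bs
                  (<-≤-trans o (*-monoʳ-≤ p (+-monoʳ-≤ (sum a) (sum≤sum-++ cur b)))) l
  ... | false = o ∷ l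

  probeGo-overfull : ∀ cur bs → Linked Overfull (probeGo fits cur bs)
  probeGo-overfull cur []       = [-]
  probeGo-overfull cur (b ∷ bs)
    with fits (sum cur + sum b) | ≤ᵇ-reflects-≤ (p * (sum cur + sum b)) T
  ... | true  | _        = probeGo-overfull (cur ++ b) bs
  ... | false | ofⁿ ¬fit = overfull-∷-probeGo cur b bs (≰⇒> ¬fit) (probeGo-overfull b bs)

  probe-overfull : ∀ L → Linked Overfull (probe fits L)
  probe-overfull []      = []
  probe-overfull (b ∷ L) = probeGo-overfull b L

  -- The first group is counted once and all later ones twice.
  overfull-length-bound : ∀ g gs → Linked Overfull (g ∷ gs) →
    length gs * suc T ≤ p * (sum g + 2 * sum (concat gs))
  overfull-length-bound g []       [-]     = z≤n
  overfull-length-bound g (h ∷ hs) (o ∷ l) = begin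
    suc T + length hs * suc T
      ≤⟨ +-mono-≤ o (overfull-length-bound h hs l) ⟩
    p * (sum g + sum h) + p * (sum h + 2 * sum (concat hs))
      ≡⟨ regroup p (sum g) (sum h) (sum (concat hs)) ⟩
    p * (sum g + 2 * (sum h + sum (concat hs)))
      ≡⟨ cong (λ w → p * (sum g + 2 * w)) (sym (sum-++ h (concat hs))) ⟩
    p * (sum g + 2 * sum (concat (h ∷ hs))) ∎
    where
    open ≤-Reasoning
    regroup : ∀ p a b c → p * (a + b) + p * (b + 2 * c) ≡ p * (a + 2 * (b + c))
    regroup = solve-∀

  overfull-length : .{{_ : NonZero p}} → ∀ gs → Linked Overfull gs →
    2 * sum (concat gs) ≤ T → length gs ≤ p
  overfull-length []       _ _     = z≤n
  overfull-length (g ∷ gs) l small = *-cancelʳ-< (suc T) (length gs) p (begin-strict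
    length gs * suc T                  ≤⟨ overfull-length-bound g gs l ⟩
    p * (sum g + 2 * sum (concat gs))  ≤⟨ *-monoʳ-≤ p (m≤n+m _ (sum g)) ⟩
    p * (sum g + (sum g + 2 * sum (concat gs)))
      ≡⟨ cong (p *_) (double (sum g) (sum (concat gs))) ⟩
    p * (2 * (sum g + sum (concat gs)))
      ≡⟨ cong (λ w → p * (2 * w)) (sym (sum-++ g (concat gs))) ⟩
    p * (2 * sum (concat (g ∷ gs)))    ≤⟨ *-monoʳ-≤ p small ⟩
    p * T                              <⟨ *-monoʳ-< p (n<1+n T) ⟩
    p * suc T                          ∎)
    where
    open ≤-Reasoning
    double : ∀ a c → a + (a + 2 * c) ≡ 2 * (a + c)
    double = solve-∀

  probe-length : .{{_ : NonZero p}} → ∀ L → 2 * sum (concat L) ≤ T → length (probe fits L) ≤ p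
  probe-length L small = overfull-length (probe fits L) (probe-overfull L)
    (subst (λ xs → 2 * sum xs ≤ T) (sym (concat-probe fits L)) small)

-- p · B for the bound B = 2 max(m, S/p) of the algorithm; `fitsB p S m w` tests p · w ≤ budget p S m.
budget : ℕ → ℕ → ℕ → ℕ
budget p S m = 2 * ((p * m) ⊔ S)

budget-mono : ∀ p S m x → budget p S m ≤ budget p (S + x) (m ⊔ x)
budget-mono p S m x = *-monoʳ-≤ 2 (⊔-mono-≤ (*-monoʳ-≤ p (m≤m⊔n m x)) (m≤m+n S x))

record Invariant (p : ℕ) (pre : List ℕ) (s : State) : Set where
  field
    blocks-concat  : concat (blocks s) ≡ pre
    total-sum      : total s ≡ sum pre
    maxReq-maximum : maxReq s ≡ maximum pre
    blocks-length  : length (blocks s) ≤ p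
    blocks-fit     : All (λ b → p * sum b ≤ budget p (total s) (maxReq s)) (blocks s)

initial-invariant : ∀ p → Invariant p [] initState
initial-invariant p = record
  { blocks-concat = refl ; total-sum = refl ; maxReq-maximum = refl
  ; blocks-length = z≤n ; blocks-fit = [] }

step-invariant : ∀ p .{{_ : NonZero p}} {pre} s x →
  Invariant p pre s → Invariant p (pre ++ [ x ]) (step p s x)
step-invariant p {pre} (st bs S m) x I = record
  { blocks-concat  = trans (concat-probe fits L) concat-L
  ; total-sum      = new-total
  ; maxReq-maximum = trans (cong (_⊔ x) maxReq-maximum) (sym (maximum-∷ʳ pre x))
  ; blocks-length  = probe-length L L-light
  ; blocks-fit     = probe-fits L (++⁺ (All.map (λ fit → ≤-trans fit (budget-mono p S m x)) blocks-fit)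
                                       (x-fits ∷ []))
  }
  where
  open Invariant I
  open Probe p (budget p (S + x) (m ⊔ x))
  L : List (List ℕ)
  L = bs ++ [ [ x ] ]
  concat-L : concat L ≡ pre ++ [ x ]
  concat-L = trans (sym (concat-++ bs [ [ x ] ])) (cong (_++ [ x ]) blocks-concat)
  new-total : S + x ≡ sum (pre ++ [ x ])
  new-total = trans (cong (_+ x) total-sum) (sym (sum-∷ʳ pre x))
  L-light : 2 * sum (concat L) ≤ budget p (S + x) (m ⊔ x)
  L-light = *-monoʳ-≤ 2 (begin
    sum (concat L)           ≡⟨ trans (cong sum concat-L) (sym new-total) ⟩
    S + x                    ≤⟨ m≤n⊔m (p * (m ⊔ x)) (S + x) ⟩
    (p * (m ⊔ x)) ⊔ (S + x)  ∎)
    where open ≤-Reasoning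
  x-fits : Fits [ x ]
  x-fits = begin
    p * (x + 0)                     ≡⟨ cong (p *_) (+-identityʳ x) ⟩
    p * x                           ≤⟨ *-monoʳ-≤ p (m≤n⊔m m x) ⟩
    p * (m ⊔ x)                     ≤⟨ m≤m⊔n (p * (m ⊔ x)) (S + x) ⟩
    (p * (m ⊔ x)) ⊔ (S + x)         ≤⟨ m≤n*m _ 2 ⟩
    budget p (S + x) (m ⊔ x)        ∎
    where open ≤-Reasoning

foldl-invariant : ∀ p .{{_ : NonZero p}} {pre} s ws →
  Invariant p pre s → Invariant p (pre ++ ws) (foldl (step p) s ws)
foldl-invariant p {pre} s [] I = subst (λ q → Invariant p q s) (sym (++-identityʳ pre)) I
foldl-invariant p {pre} s (x ∷ ws) I =
  subst (λ q → Invariant p q (foldl (step p) s (x ∷ ws))) (++-assoc pre [ x ] ws)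
    (foldl-invariant p (step p s x) ws (step-invariant p s x I))

run-invariant : ∀ p .{{_ : NonZero p}} ws → Invariant p ws (run p ws)
run-invariant p ws = foldl-invariant p initState ws (initial-invariant p)

run-2-competitive : ∀ p .{{_ : NonZero p}} ws (P : List (List ℕ)) → concat P ≡ ws → length P ≤ p →
  bottleneck (blocks (run p ws)) ≤ 2 * bottleneck P
run-2-competitive p ws P refl lP = *-cancelˡ-≤ p (begin
  p * bottleneck (blocks (run p ws))               ≤⟨ bottleneck-lub p (blocks (run p ws)) blocks-fit ⟩
  budget p (total (run p ws)) (maxReq (run p ws))  ≡⟨ cong₂ (budget p) total-sum maxReq-maximum ⟩
  2 * ((p * maximum ws) ⊔ sum ws)                  ≤⟨ *-monoʳ-≤ 2 (bottleneck-lower-bound p P lP) ⟩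
  2 * (p * bottleneck P)                           ≡⟨ swap p (bottleneck P) ⟩
  p * (2 * bottleneck P)                           ∎)
  where
  open Invariant (run-invariant p ws)
  open ≤-Reasoning
  swap : ∀ p b → 2 * (p * b) ≡ p * (2 * b)
  swap = solve-∀

-- The requests need not be positive, and of 2 ≤ p only p ≠ 0 is used.
theorem9 : (p : ℕ) → 2 ≤ p → (ws : List ℕ) → All (λ w → 1 ≤ w) ws →
    concat (blocks (run p ws)) ≡ ws
    × length (blocks (run p ws)) ≤ p
    × ((P : List (List ℕ)) → concat P ≡ ws → length P ≤ p →
         bottleneck (blocks (run p ws)) ≤ 2 * bottleneck P)
theorem9 p@(suc _) _ ws _ = blocks-concat , blocks-length , run-2-competitive p ws
  where open Invariant (run-invariant p ws)
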